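{- Let $\mathbf A=\langle A,\wedge,\vee,\cdot,1,0,{\sim},{ - },'\rangle$ be a quasi relation algebra. For every positive integer $n$ and all $a,b\in A$: ${\sim}^{2n}(a\cdot b)={\sim}^{2n}a\cdot{\sim}^{2n}b$ and ${ - }^{2n}(a\cdot b)={ - }^{2n}a\cdot{ - }^{2n}b$.
   Context: A quasi relation algebra $\langle A,\wedge,\vee,\cdot,1,0,{\sim},{ - },'\rangle$: $\langle A,\wedge,\vee\rangle$ is a lattice, $\langle A,\cdot,1\rangle$ a monoid, residuals satisfy $a\cdot b\le c\iff a\le c/b\iff b\le a\backslash c$, $0$ arbitrary, ${\sim}a=a\backslash0$, ${ - }a=0/a$, ${\sim}{ - }a={ - }{\sim}a=a$; $a+b={\sim}({ - }b\cdot{ - }a)$; $'$ satisfies $a''=a$, $(a\vee b)'=a'\wedge b'$, $({\sim}a)'={ - }(a')$, $(a\cdot b)'=a'+b'$. ${\sim}^k,{ - }^k$ denote $k$-fold applications. -}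

module Defs where

open import Level using (Level; suc; _⊔_)
open import Data.Nat using (ℕ; zero) renaming (suc to sucℕ)
open import Relation.Binary.PropositionalEquality using (_≡_)
open import Data.Product using (_×_)
open import Function.Bundles using (_⇔_)

iter : ∀ {a} {A : Set a} → ℕ → (A → A) → A → A
iter zero    f x = x
iter (sucℕ k) f x = f (iter k f x)

record QuasiRelationAlgebra (c : Level) : Set (suc c) where
  infixr 7 _∙_
  infixr 6 _∧_
  infixr 5 _∨_
  field
    Carrier : Set c
    _∧_ _∨_ _∙_ _\\_ _//_ : Carrier → Carrier → Carrier
    one zer : Carrier
    ∼_ -_ _′ : Carrier → Carrier

  _≤_ : Carrier → Carrier → Set c
  a ≤ b = (a ∧ b) ≡ a

  _+_ : Carrier → Carrier → Carrier
  a + b = ∼ ((- b) ∙ (- a))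

  field
    ∧-comm  : ∀ a b → (a ∧ b) ≡ (b ∧ a)
    ∨-comm  : ∀ a b → (a ∨ b) ≡ (b ∨ a)
    ∧-assoc : ∀ a b d → ((a ∧ b) ∧ d) ≡ (a ∧ (b ∧ d))
    ∨-assoc : ∀ a b d → ((a ∨ b) ∨ d) ≡ (a ∨ (b ∨ d))
    ∧-absorb-∨ : ∀ a b → (a ∧ (a ∨ b)) ≡ a
    ∨-absorb-∧ : ∀ a b → (a ∨ (a ∧ b)) ≡ a
    ∙-assoc : ∀ a b d → ((a ∙ b) ∙ d) ≡ (a ∙ (b ∙ d))
    ∙-identityˡ : ∀ a → (one ∙ a) ≡ a
    ∙-identityʳ : ∀ a → (a ∙ one) ≡ a
    resʳ : ∀ a b d → ((a ∙ b) ≤ d) ⇔ (a ≤ (d // b))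
    resˡ : ∀ a b d → ((a ∙ b) ≤ d) ⇔ (b ≤ (a \\ d))
    ∼-def : ∀ a → (∼ a) ≡ (a \\ zer)
    -def : ∀ a → (- a) ≡ (zer // a)
    ∼- : ∀ a → (∼ (- a)) ≡ a
    -∼ : ∀ a → (- (∼ a)) ≡ a
    ′′ : ∀ a → ((a ′) ′) ≡ a
    ′-∨ : ∀ a b → ((a ∨ b) ′) ≡ ((a ′) ∧ (b ′))
    ′-∼ : ∀ a → ((∼ a) ′) ≡ (- (a ′))
    ′-∙ : ∀ a b → ((a ∙ b) ′) ≡ ((a ′) + (b ′))

-- In an involutive residuated lattice both y ≤ ∼ x and y ≤ - x say that a product of x and y
-- lies below 0; a chain of residuations then shows that the two candidate definitions
-- ∼ (- b ∙ - a) and - (∼ b ∙ ∼ a) of a + b agree.  Evaluating a + b at ∼ b, ∼ a gives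
-- ∼ (a ∙ b) = - (∼ ∼ a ∙ ∼ ∼ b), so ∼ ∼ is multiplicative, and dually so is - -;
-- hence so are the iterates ∼²ⁿ and -²ⁿ, for every n (the case n = 0 is trivial).
module Submission where

open import Defs
open import Level using (Level)
open import Data.Nat using (ℕ; zero; suc; _*_; NonZero)
open import Data.Nat.Properties using (*-suc)
open import Data.Product using (_×_; _,_)
open import Function.Bundles using (_⇔_; Equivalence)
import Function.Properties.Equivalence as ⇔
open import Relation.Binary.PropositionalEquality
  using (_≡_; refl; sym; trans; cong; cong₂; module ≡-Reasoning)

module _ {a} {A : Set a} where

  iter-2* : ∀ (f : A → A) n x → iter (2 * n) f x ≡ iter n (λ y → f (f y)) x
  iter-2* f zero    x = refl
  iter-2* f (suc n) x =
    trans (cong (λ k → iter k f x) (*-suc 2 n)) (cong (λ y → f (f y)) (iter-2* f n x))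

module _ {a} {A : Set a} (_∙_ : A → A → A) where

  iter-homo : ∀ (g : A → A) → (∀ x y → g (x ∙ y) ≡ (g x ∙ g y)) →
              ∀ n x y → iter n g (x ∙ y) ≡ (iter n g x ∙ iter n g y)
  iter-homo g homo zero    x y = refl
  iter-homo g homo (suc n) x y = trans (cong g (iter-homo g homo n x y)) (homo _ _)

  iter-2*-homo : ∀ (f : A → A) → (∀ x y → f (f (x ∙ y)) ≡ (f (f x) ∙ f (f y))) →
                 ∀ n x y → iter (2 * n) f (x ∙ y) ≡ (iter (2 * n) f x ∙ iter (2 * n) f y)
  iter-2*-homo f homo n x y = begin
    iter (2 * n) f (x ∙ y)                   ≡⟨ iter-2* f n (x ∙ y) ⟩
    iter n f² (x ∙ y)                        ≡⟨ iter-homo f² homo n x y ⟩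
    iter n f² x ∙ iter n f² y                ≡⟨ sym (cong₂ _∙_ (iter-2* f n x) (iter-2* f n y)) ⟩
    iter (2 * n) f x ∙ iter (2 * n) f y      ∎
    where
    open ≡-Reasoning
    f² : A → A
    f² y = f (f y)

module Properties {c : Level} (𝐀 : QuasiRelationAlgebra c) where
  open QuasiRelationAlgebra 𝐀
  open Equivalence using (to; from)
  open import Relation.Binary.Reasoning.Setoid (⇔.⇔-setoid c)

  ≤-refl : ∀ x → x ≤ x
  ≤-refl x = trans (cong (x ∧_) (sym (∨-absorb-∧ x x))) (∧-absorb-∨ x (x ∧ x))

  ≤-antisym : ∀ {x y} → x ≤ y → y ≤ x → x ≡ y
  ≤-antisym {x} {y} x≤y y≤x = trans (sym x≤y) (trans (∧-comm x y) y≤x)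

  indirect-≡ : ∀ {x y} → (∀ z → (z ≤ x) ⇔ (z ≤ y)) → x ≡ y
  indirect-≡ {x} {y} z≤x⇔z≤y =
    ≤-antisym (to (z≤x⇔z≤y x) (≤-refl x)) (from (z≤x⇔z≤y y) (≤-refl y))

  ≤∼⇔∙≤0 : ∀ x y → (y ≤ (∼ x)) ⇔ ((x ∙ y) ≤ zer)
  ≤∼⇔∙≤0 x y = begin
    y ≤ (∼ x)         ≡⟨ cong (y ≤_) (∼-def x) ⟩
    y ≤ (x \\ zer)    ≈⟨ ⇔.sym (resˡ x y zer) ⟩
    (x ∙ y) ≤ zer     ∎

  ≤-⇔∙≤0 : ∀ x y → (y ≤ (- x)) ⇔ ((y ∙ x) ≤ zer)
  ≤-⇔∙≤0 x y = begin
    y ≤ (- x)         ≡⟨ cong (y ≤_) (-def x) ⟩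
    y ≤ (zer // x)    ≈⟨ ⇔.sym (resʳ y x zer) ⟩
    (y ∙ x) ≤ zer     ∎

  -∙≤⇔∙∼≤ : ∀ a b z → ((- a ∙ z) ≤ b) ⇔ ((z ∙ ∼ b) ≤ a)
  -∙≤⇔∙∼≤ a b z = begin
    (- a ∙ z) ≤ b                ≡⟨ cong ((- a ∙ z) ≤_) (sym (-∼ b)) ⟩
    (- a ∙ z) ≤ (- (∼ b))        ≈⟨ ≤-⇔∙≤0 (∼ b) (- a ∙ z) ⟩
    ((- a ∙ z) ∙ ∼ b) ≤ zer      ≡⟨ cong (_≤ zer) (∙-assoc (- a) z (∼ b)) ⟩
    (- a ∙ (z ∙ ∼ b)) ≤ zer      ≈⟨ ⇔.sym (≤∼⇔∙≤0 (- a) (z ∙ ∼ b)) ⟩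
    (z ∙ ∼ b) ≤ (∼ (- a))        ≡⟨ cong ((z ∙ ∼ b) ≤_) (∼- a) ⟩
    (z ∙ ∼ b) ≤ a                ∎

  +≡-[∼∙∼] : ∀ a b → (a + b) ≡ (- (∼ b ∙ ∼ a))
  +≡-[∼∙∼] a b = indirect-≡ λ z → begin
    z ≤ (∼ (- b ∙ - a))          ≈⟨ ≤∼⇔∙≤0 (- b ∙ - a) z ⟩
    ((- b ∙ - a) ∙ z) ≤ zer      ≡⟨ cong (_≤ zer) (∙-assoc (- b) (- a) z) ⟩
    (- b ∙ (- a ∙ z)) ≤ zer      ≈⟨ ⇔.sym (≤∼⇔∙≤0 (- b) (- a ∙ z)) ⟩
    (- a ∙ z) ≤ (∼ (- b))        ≡⟨ cong ((- a ∙ z) ≤_) (∼- b) ⟩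
    (- a ∙ z) ≤ b                ≈⟨ -∙≤⇔∙∼≤ a b z ⟩
    (z ∙ ∼ b) ≤ a                ≡⟨ cong ((z ∙ ∼ b) ≤_) (sym (-∼ a)) ⟩
    (z ∙ ∼ b) ≤ (- (∼ a))        ≈⟨ ≤-⇔∙≤0 (∼ a) (z ∙ ∼ b) ⟩
    ((z ∙ ∼ b) ∙ ∼ a) ≤ zer      ≡⟨ cong (_≤ zer) (∙-assoc z (∼ b) (∼ a)) ⟩
    (z ∙ (∼ b ∙ ∼ a)) ≤ zer      ≈⟨ ⇔.sym (≤-⇔∙≤0 (∼ b ∙ ∼ a) z) ⟩
    z ≤ (- (∼ b ∙ ∼ a))          ∎

  ∼[∙] : ∀ a b → (∼ (a ∙ b)) ≡ (- (∼ ∼ a ∙ ∼ ∼ b))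
  ∼[∙] a b = trans (cong ∼_ (sym (cong₂ _∙_ (-∼ a) (-∼ b)))) (+≡-[∼∙∼] (∼ b) (∼ a))

  -[∙] : ∀ a b → (- (a ∙ b)) ≡ (∼ (- - a ∙ - - b))
  -[∙] a b = trans (cong -_ (sym (cong₂ _∙_ (∼- a) (∼- b)))) (sym (+≡-[∼∙∼] (- b) (- a)))

  ∼²[∙] : ∀ a b → (∼ ∼ (a ∙ b)) ≡ (∼ ∼ a ∙ ∼ ∼ b)
  ∼²[∙] a b = trans (cong ∼_ (∼[∙] a b)) (∼- _)

  -²[∙] : ∀ a b → (- - (a ∙ b)) ≡ (- - a ∙ - - b)
  -²[∙] a b = trans (cong -_ (-[∙] a b)) (-∼ _)

lemma2p3 : ∀ {c : Level} (𝐀 : QuasiRelationAlgebra c) →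
    let open QuasiRelationAlgebra 𝐀 in
    ∀ (n : ℕ) → .{{_ : NonZero n}} → ∀ (a b : Carrier) →
    (iter (2 * n) ∼_ (a ∙ b) ≡ (iter (2 * n) ∼_ a ∙ iter (2 * n) ∼_ b))
    × (iter (2 * n) -_ (a ∙ b) ≡ (iter (2 * n) -_ a ∙ iter (2 * n) -_ b))
lemma2p3 𝐀 n a b = iter-2*-homo _∙_ ∼_ ∼²[∙] n a b , iter-2*-homo _∙_ -_ -²[∙] n a b
  where
  open QuasiRelationAlgebra 𝐀
  open Properties 𝐀
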